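{- $\mathcal{P} < \mathcal{P}(\supset)$.
   Context: Logics are evaluated on causal multiteams (finite multisets of assignments over a finite signature together with recursive structural equations). $\mathcal{PCO}$ is built from $\mathcal{CO}$ literals and probabilistic atoms $\Pr(\alpha)\geq\epsilon$, $\Pr(\alpha)>\epsilon$, $\Pr(\alpha)\geq\Pr(\beta)$, $\Pr(\alpha)>\Pr(\beta)$ ($\alpha,\beta\in\mathcal{CO}$, $\epsilon\in[0,1]\cap\mathbb Q$), closed under $\land$, global disjunction $\sqcup$, selective implication $\alpha\supset\varphi$ and interventionist counterfactual $\mathbf X=\mathbf x\,\Box\!\!\rightarrow\varphi$. $\mathcal{P}$ is the fragment without $\supset$ and $\Box\!\!\rightarrow$; $\mathcal{P}(\supset)$ is the fragment without $\Box\!\!\rightarrow$. $\mathcal L<\mathcal L'$ means every formula of $\mathcal L$ is equivalent (satisfied by the same causal multiteams of the signature) to a formula of $\mathcal L'$ but not vice versa. -}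

module Defs where

open import Data.Nat as ℕ using (ℕ; zero; suc)
open import Data.Fin using (Fin; _≟_)
open import Data.Bool using (Bool; true; false; _∧_; _∨_; not; if_then_else_)
open import Data.Maybe using (Maybe; just; nothing; is-nothing)
open import Data.List using (List; []; _∷_; length; map)
open import Data.List.Relation.Unary.All using (All)
open import Data.Rational using (ℚ; 0ℚ; 1ℚ; _/_) renaming (_≤_ to _≤ℚ_; _<_ to _<ℚ_)
open import Data.Integer using (+_)
open import Data.Product using (Σ; _×_; _,_)
open import Data.Sum using (_⊎_)
open import Data.Unit using (⊤)
open import Data.Empty using (⊥)
open import Relation.Binary.PropositionalEquality using (_≡_; _≢_)
open import Relation.Nullary.Decidable using (⌊_⌋)

record Sig : Set where
  field
    n        : ℕ
    rng      : Fin n → ℕ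
    nonempty : ∀ i → 1 ℕ.≤ rng i
open Sig public

Asg : Sig → Set
Asg σ = (i : Fin (n σ)) → Fin (rng σ i)

Intervention : Sig → Set
Intervention σ = (i : Fin (n σ)) → Maybe (Fin (rng σ i))

-- Function component: the set of endogenous variables and, for each
-- variable V, its structural function F_V (read off an assignment; only
-- meaningful for endogenous V; recursiveness is imposed in CausalMultiteam).
record FunComp (σ : Sig) : Set where
  constructor fc
  field
    endo : Fin (n σ) → Bool
    fun  : (i : Fin (n σ)) → Asg σ → Fin (rng σ i)
open FunComp public

iter : {A : Set} → ℕ → (A → A) → A → A
iter zero    f a = a
iter (suc k) f a = iter k f (f a)

module _ {σ : Sig} where

  step : Intervention σ → FunComp σ → Asg σ → Asg σ → Asg σ
  step X F s u i with X i
  ... | just x  = x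
  ... | nothing = if endo F i then fun F i u else s i

  -- s ↦ s_{X=x}: set X to x and recompute the remaining endogenous
  -- variables; for recursive F, n rounds of simultaneous update reach the
  -- unique solution.
  intervene : Intervention σ → FunComp σ → Asg σ → Asg σ
  intervene X F s = iter (n σ) (step X F s) s

  doF : Intervention σ → FunComp σ → FunComp σ
  doF X F = fc (λ i → endo F i ∧ is-nothing (X i)) (fun F)

data CO (σ : Sig) : Set where
  eqᶜ neqᶜ : (i : Fin (n σ)) → Fin (rng σ i) → CO σ
  _∧ᶜ_ _∨ᶜ_ _⊃ᶜ_ : CO σ → CO σ → CO σ
  _□→ᶜ_ : Intervention σ → CO σ → CO σ

evalCO : {σ : Sig} → FunComp σ → CO σ → Asg σ → Bool
evalCO F (eqᶜ i v)  s = ⌊ s i ≟ v ⌋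
evalCO F (neqᶜ i v) s = not ⌊ s i ≟ v ⌋
evalCO F (α ∧ᶜ β)   s = evalCO F α s ∧ evalCO F β s
evalCO F (α ∨ᶜ β)   s = evalCO F α s ∨ evalCO F β s
evalCO F (α ⊃ᶜ β)   s = not (evalCO F α s) ∨ evalCO F β s
evalCO F (X □→ᶜ α)  s = evalCO (doF X F) α (intervene X F s)

data PCO (σ : Sig) : Set where
  eqᵖ neqᵖ : (i : Fin (n σ)) → Fin (rng σ i) → PCO σ
  Pr≥ Pr> : CO σ → (ε : ℚ) → 0ℚ ≤ℚ ε → ε ≤ℚ 1ℚ → PCO σ
  Pr≥Pr Pr>Pr : CO σ → CO σ → PCO σ
  _∧ᵖ_ _⊔_ : PCO σ → PCO σ → PCO σ
  _⊃_ : CO σ → PCO σ → PCO σ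
  _□→_ : Intervention σ → PCO σ → PCO σ

select : {A : Set} → (A → Bool) → List A → List A
select p []       = []
select p (x ∷ xs) = if p x then x ∷ select p xs else select p xs

-- Pr_T(α) = |T^α| / |T|; the empty multiteam satisfies all
-- probabilistic atoms.
ProbRel : (ℚ → ℚ → Set) → (ℕ → ℚ) → (ℕ → ℚ) → ℕ → Set
ProbRel R a b zero    = ⊤
ProbRel R a b (suc m) = R (a (suc m)) (b (suc m))

prob : ℕ → ℕ → ℚ
prob c zero    = 0ℚ
prob c (suc m) = + c / suc m

module _ {σ : Sig} where

  cnt : FunComp σ → CO σ → List (Asg σ) → ℕ
  cnt F α T = length (select (evalCO F α) T)

  sat : FunComp σ → List (Asg σ) → PCO σ → Set
  sat F T (eqᵖ i v)  = All (λ s → s i ≡ v) T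
  sat F T (neqᵖ i v) = All (λ s → s i ≢ v) T
  sat F T (Pr≥ α ε _ _) = ProbRel _≤ℚ_ (λ _ → ε) (prob (cnt F α T)) (length T)
  sat F T (Pr> α ε _ _) = ProbRel _<ℚ_ (λ _ → ε) (prob (cnt F α T)) (length T)
  sat F T (Pr≥Pr α β) = ProbRel _≤ℚ_ (prob (cnt F β T)) (prob (cnt F α T)) (length T)
  sat F T (Pr>Pr α β) = ProbRel _<ℚ_ (prob (cnt F β T)) (prob (cnt F α T)) (length T)
  sat F T (φ ∧ᵖ ψ) = sat F T φ × sat F T ψ
  sat F T (φ ⊔ ψ)  = sat F T φ ⊎ sat F T ψ
  sat F T (α ⊃ φ)  = sat F (select (evalCO F α) T) φ
  sat F T (X □→ φ) = sat (doF X F) (map (intervene X F) T) φ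

-- Recursiveness: a rank
-- function such that each F_V (V endogenous) only depends on variables of
-- strictly smaller rank (i.e. the causal graph is acyclic).

record CausalMultiteam (σ : Sig) : Set where
  field
    F          : FunComp σ
    team       : List (Asg σ)
    rank       : Fin (n σ) → ℕ
    recursive  : ∀ i → endo F i ≡ true → ∀ (s t : Asg σ) →
                 (∀ j → rank j ℕ.< rank i → s j ≡ t j) → fun F i s ≡ fun F i t
    compatible : All (λ s → ∀ i → endo F i ≡ true → s i ≡ fun F i s) team
open CausalMultiteam public

_⊨_ : {σ : Sig} → CausalMultiteam σ → PCO σ → Set
T ⊨ φ = sat (F T) (team T) φ

Equivalent : (σ : Sig) → PCO σ → PCO σ → Set
Equivalent σ φ ψ = ∀ (T : CausalMultiteam σ) → (T ⊨ φ → T ⊨ ψ) × (T ⊨ ψ → T ⊨ φ)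

InP⊃ : {σ : Sig} → PCO σ → Set
InP⊃ (φ ∧ᵖ ψ) = InP⊃ φ × InP⊃ ψ
InP⊃ (φ ⊔ ψ)  = InP⊃ φ × InP⊃ ψ
InP⊃ (α ⊃ φ)  = InP⊃ φ
InP⊃ (X □→ φ) = ⊥
InP⊃ _        = ⊤

InP : {σ : Sig} → PCO σ → Set
InP (φ ∧ᵖ ψ) = InP φ × InP ψ
InP (φ ⊔ ψ)  = InP φ × InP ψ
InP (α ⊃ φ)  = ⊥
InP (X □→ φ) = ⊥
InP _        = ⊤

-- Over one variable X with values 0, 1, 2 and no endogenous variables, a multiteam is
-- determined by its value counts, and every probabilistic atom of P holds iff some integer
-- linear functional ℓ of the counts is ≥ 0 (resp. > 0).  On the multiteams T⁺ k and T⁻ k with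
-- counts (k+1, 2k+1, 2) and (k+1, 2k+3, 2), such an ℓ takes the values s·k + o and s·k + o + d.
-- If s ≠ 0 both have the sign of s for large k; if s = 0, a finite case analysis over the
-- functionals coming from atoms shows that d never lowers the sign of o.  Literals fail on
-- both families, so every formula of P true on T⁺ k is true on T⁻ k for all large k.  But
-- X ≠ 2 ⊃ Pr(X = 0) ≥ 1/3 holds on T⁺ k, where the conditional frequency is (k+1)/(3k+2),
-- and fails on T⁻ k, where it is (k+1)/(3k+4).

module Submission where

open import Defs
open import Data.Bool using (Bool; true; false; if_then_else_)
open import Data.Empty using (⊥-elim)
open import Data.Fin using (Fin)
open import Data.Fin.Patterns using (0F; 1F; 2F)
open import Data.Integer as ℤ using (ℤ; +_; -[1+_]; 0ℤ; 1ℤ; -1ℤ; _+_; _-_; -_; _*_; ∣_∣; +≤+; +<+)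
import Data.Integer.Properties as ℤP
open import Data.Integer.Tactic.RingSolver using (solve-∀)
open import Data.List using (List; []; _∷_; _++_; length; replicate)
open import Data.List.Properties using (length-++; length-replicate)
open import Data.List.Relation.Unary.All as All using (All; universal)
import Data.List.Relation.Unary.All.Properties as All
open import Data.Nat as ℕ using (ℕ; zero; suc; z≤n; s≤s)
import Data.Nat.Properties as ℕP
open import Data.Product using (Σ; ∃-syntax; _×_; _,_; proj₁; proj₂)
open import Data.Rational as ℚ using (ℚ; ↥_; ↧_; 0ℚ; 1ℚ; _/_; *≤*)
import Data.Rational.Properties as ℚP
open import Data.Rational.Unnormalised as ℚᵘ using (mkℚᵘ; *≤*; *<*)
import Data.Rational.Unnormalised.Properties as ℚᵘP
import Data.Sum
open import Data.Unit using (tt)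
open import Function using (id; _∘_; case_of_; _⇔_; mk⇔; Equivalence)
open import Function.Construct.Composition using (_⇔-∘_)
open import Relation.Binary.Definitions using (tri<; tri≈; tri>)
open import Relation.Binary.PropositionalEquality
open import Relation.Nullary using (¬_)

open Equivalence using (to; from)

≤⇔0≤- : ∀ {i j} → i ℤ.≤ j ⇔ 0ℤ ℤ.≤ j - i
≤⇔0≤- = mk⇔ ℤP.i≤j⇒0≤j-i ℤP.0≤i-j⇒j≤i

<⇔0<- : ∀ {i j} → i ℤ.< j ⇔ 0ℤ ℤ.< j - i
<⇔0<- = mk⇔
  (λ i<j → ℤP.≰⇒> (λ j-i≤0 → ℤP.<⇒≱ i<j (ℤP.i-j≤0⇒i≤j j-i≤0)))
  (λ 0<j-i → ℤP.≰⇒> (λ j≤i → ℤP.<⇒≱ 0<j-i (ℤP.i≤j⇒i-j≤0 j≤i)))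

toℚᵘ-/-suc : ∀ i m → ℚ.toℚᵘ (i / suc m) ℚᵘ.≃ mkℚᵘ i m
toℚᵘ-/-suc i m = ℚP.toℚᵘ-fromℚᵘ (mkℚᵘ i m)

≤-/-suc : ∀ p i m → p ℚ.≤ i / suc m ⇔ ↥ p * + suc m ℤ.≤ i * ↧ p
≤-/-suc p@record{} i m = mk⇔
  (λ h → case ℚᵘP.≤-respʳ-≃ (toℚᵘ-/-suc i m) (ℚP.toℚᵘ-mono-≤ h) of λ where (*≤* h′) → h′)
  (λ h → ℚP.toℚᵘ-cancel-≤ (ℚᵘP.≤-respʳ-≃ (ℚᵘP.≃-sym (toℚᵘ-/-suc i m)) (*≤* h)))

<-/-suc : ∀ p i m → p ℚ.< i / suc m ⇔ ↥ p * + suc m ℤ.< i * ↧ p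
<-/-suc p@record{} i m = mk⇔
  (λ h → case ℚᵘP.<-respʳ-≃ (toℚᵘ-/-suc i m) (ℚP.toℚᵘ-mono-< h) of λ where (*<* h′) → h′)
  (λ h → ℚP.toℚᵘ-cancel-< (ℚᵘP.<-respʳ-≃ (ℚᵘP.≃-sym (toℚᵘ-/-suc i m)) (*<* h)))

/-suc-≤-/-suc : ∀ i j m → i / suc m ℚ.≤ j / suc m ⇔ i ℤ.≤ j
/-suc-≤-/-suc i j m = mk⇔
  (λ h → case ℚᵘP.≤-respˡ-≃ (toℚᵘ-/-suc i m) (ℚᵘP.≤-respʳ-≃ (toℚᵘ-/-suc j m) (ℚP.toℚᵘ-mono-≤ h)) of λ where
    (*≤* h′) → ℤP.*-cancelʳ-≤-pos i j (+ suc m) h′)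
  (λ h → ℚP.toℚᵘ-cancel-≤ (ℚᵘP.≤-respˡ-≃ (ℚᵘP.≃-sym (toℚᵘ-/-suc i m))
    (ℚᵘP.≤-respʳ-≃ (ℚᵘP.≃-sym (toℚᵘ-/-suc j m)) (*≤* (ℤP.*-monoʳ-≤-nonNeg (+ suc m) h)))))

/-suc-<-/-suc : ∀ i j m → i / suc m ℚ.< j / suc m ⇔ i ℤ.< j
/-suc-<-/-suc i j m = mk⇔
  (λ h → case ℚᵘP.<-respˡ-≃ (toℚᵘ-/-suc i m) (ℚᵘP.<-respʳ-≃ (toℚᵘ-/-suc j m) (ℚP.toℚᵘ-mono-< h)) of λ where
    (*<* h′) → ℤP.*-cancelʳ-<-nonNeg (+ suc m) h′)
  (λ h → ℚP.toℚᵘ-cancel-< (ℚᵘP.<-respˡ-≃ (ℚᵘP.≃-sym (toℚᵘ-/-suc i m))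
    (ℚᵘP.<-respʳ-≃ (ℚᵘP.≃-sym (toℚᵘ-/-suc j m)) (*<* (ℤP.*-monoʳ-<-pos (+ suc m) h)))))

Eventually : (ℕ → Set) → Set
Eventually P = ∃[ M ] ∀ {k} → M ℕ.≤ k → P k

eventually-map : ∀ {P Q : ℕ → Set} → (∀ {k} → P k → Q k) → Eventually P → Eventually Q
eventually-map f (M , p) = M , f ∘ p

eventually-zip : ∀ {P Q : ℕ → Set} → Eventually P → Eventually Q → Eventually (λ k → P k × Q k)
eventually-zip (M , p) (N , q) = M ℕ.⊔ N , λ le →
  p (ℕP.≤-trans (ℕP.m≤m⊔n M N) le) , q (ℕP.≤-trans (ℕP.m≤n⊔m M N) le)

-- x ≤ₛ y : the sign of x is at most that of y in the order - < 0 < +.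
infix 4 _≤ₛ_
_≤ₛ_ : ℤ → ℤ → Set
x ≤ₛ y = (0ℤ ℤ.≤ x → 0ℤ ℤ.≤ y) × (0ℤ ℤ.< x → 0ℤ ℤ.< y)

≤ₛ-pos : ∀ {x y} → 0ℤ ℤ.< y → x ≤ₛ y
≤ₛ-pos 0<y = (λ _ → ℤP.<⇒≤ 0<y) , (λ _ → 0<y)

≤ₛ-neg : ∀ {x y} → x ℤ.< 0ℤ → x ≤ₛ y
≤ₛ-neg x<0 = (λ 0≤x → ⊥-elim (ℤP.<⇒≱ x<0 0≤x)) , (λ 0<x → ⊥-elim (ℤP.<-asym 0<x x<0))

≤ₛ-+-nonNeg : ∀ {x d} → 0ℤ ℤ.≤ d → x ≤ₛ x + d
≤ₛ-+-nonNeg 0≤d = (λ 0≤x → ℤP.+-mono-≤ 0≤x 0≤d) , (λ 0<x → ℤP.+-mono-<-≤ 0<x 0≤d)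

≤ₛ-+-multiple : ∀ n x → x ≤ₛ x + + n * x
≤ₛ-+-multiple n x =
  (λ 0≤x → ℤP.+-mono-≤ 0≤x (0≤n*x 0≤x)) , (λ 0<x → ℤP.+-mono-<-≤ 0<x (0≤n*x (ℤP.<⇒≤ 0<x)))
  where 0≤n*x : 0ℤ ℤ.≤ x → 0ℤ ℤ.≤ + n * x
        0≤n*x 0≤x = subst (ℤ._≤ + n * x) (ℤP.*-zeroʳ (+ n)) (ℤP.*-monoˡ-≤-nonNeg (+ n) 0≤x)

eventually-positive : ∀ {u} → 0ℤ ℤ.< u → ∀ c → Eventually (λ k → 0ℤ ℤ.< u * + k + c)
eventually-positive {u} 0<u c = suc ∣ c ∣ , λ {k} le → begin-strict
  0ℤ                 <⟨ +<+ (s≤s z≤n) ⟩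
  1ℤ                 ≤⟨ ℤP.+-monoʳ-≤ 1ℤ (∣c∣+c≥0 c) ⟩
  1ℤ + (+ ∣ c ∣ + c) ≡⟨ ℤP.+-assoc 1ℤ (+ ∣ c ∣) c ⟨
  + suc ∣ c ∣ + c    ≤⟨ ℤP.+-monoˡ-≤ c (+≤+ le) ⟩
  + k + c            ≡⟨ cong (_+ c) (ℤP.*-identityˡ (+ k)) ⟨
  1ℤ * + k + c       ≤⟨ ℤP.+-monoˡ-≤ c (ℤP.*-monoʳ-≤-nonNeg (+ k) (ℤP.i<j⇒suc[i]≤j 0<u)) ⟩
  u * + k + c        ∎
  where
  open ℤP.≤-Reasoning
  ∣c∣+c≥0 : ∀ c → 0ℤ ℤ.≤ + ∣ c ∣ + c
  ∣c∣+c≥0 (+ n)    = +≤+ z≤n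
  ∣c∣+c≥0 -[1+ n ] = ℤP.≤-reflexive (sym (ℤP.n⊖n≡0 (suc n)))

eventually-negative : ∀ {u} → u ℤ.< 0ℤ → ∀ c → Eventually (λ k → u * + k + c ℤ.< 0ℤ)
eventually-negative {u} u<0 c =
  eventually-map negate (eventually-positive (ℤP.neg-mono-< u<0) (- c))
  where
  negate : ∀ {k} → 0ℤ ℤ.< - u * + k + - c → u * + k + c ℤ.< 0ℤ
  negate {k} h = ℤP.neg-cancel-< (subst (0ℤ ℤ.<_) (negated u (+ k) c) h)
    where negated : ∀ u k c → - u * k + - c ≡ - (u * k + c)
          negated = solve-∀

eventually-≤ₛ : ∀ u v d → (u ≡ 0ℤ → v ≤ₛ v + d) → Eventually (λ k → u * + k + v ≤ₛ u * + k + v + d)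
eventually-≤ₛ u v d at-zero with ℤP.<-cmp u 0ℤ
... | tri< u<0 _ _ = eventually-map ≤ₛ-neg (eventually-negative u<0 v)
... | tri≈ _ refl _ = 0 , λ _ → subst (λ x → x ≤ₛ x + d) (sym (ℤP.+-identityˡ v)) (at-zero refl)
... | tri> _ _ 0<u = eventually-map (λ {k} → ≤ₛ-pos ∘ subst (0ℤ ℤ.<_) (sym (ℤP.+-assoc (u * + k) v d)))
                                    (eventually-positive 0<u (v + d))

σ₃ : Sig
σ₃ = record { n = 1 ; rng = λ _ → 3 ; nonempty = λ _ → s≤s z≤n }

pt : Fin 3 → Asg σ₃
pt v _ = v

F₀ : FunComp σ₃
F₀ = fc (λ _ → false) (λ i s → s i)

causalMultiteam : List (Asg σ₃) → CausalMultiteam σ₃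
causalMultiteam T = record { F = F₀ ; team = T ; rank = λ _ → 0 ; recursive = λ _ ()
                  ; compatible = universal (λ _ _ ()) T }

team₃ : ℕ → ℕ → ℕ → List (Asg σ₃)
team₃ a b c = replicate a (pt 0F) ++ replicate b (pt 1F) ++ replicate c (pt 2F)

holds : CO σ₃ → Fin 3 → Bool
holds α v = evalCO F₀ α (pt v)

select-++ : ∀ {A : Set} (p : A → Bool) xs ys → select p (xs ++ ys) ≡ select p xs ++ select p ys
select-++ p []       ys = refl
select-++ p (x ∷ xs) ys with p x
... | true  = cong (x ∷_) (select-++ p xs ys)
... | false = select-++ p xs ys

select-replicate : ∀ {A : Set} (p : A → Bool) n x → select p (replicate n x) ≡ (if p x then replicate n x else [])
select-replicate p zero    x with p x
... | true  = refl
... | false = refl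
select-replicate p (suc n) x with p x | select-replicate p n x
... | true  | eq = cong (x ∷_) eq
... | false | eq = eq

select-true : ∀ {A : Set} (xs : List A) → select (λ _ → true) xs ≡ xs
select-true []       = refl
select-true (x ∷ xs) = cong (x ∷_) (select-true xs)

bit : Bool → ℤ
bit true  = 1ℤ
bit false = 0ℤ

weigh : (Fin 3 → ℤ) → ℕ → ℕ → ℕ → ℤ
weigh ℓ a b c = ℓ 0F * + a + (ℓ 1F * + b + ℓ 2F * + c)

+length-select-++ : ∀ {A : Set} (p : A → Bool) xs ys →
                    + length (select p (xs ++ ys)) ≡ + length (select p xs) + + length (select p ys)
+length-select-++ p xs ys = begin
  + length (select p (xs ++ ys))                     ≡⟨ cong (+_ ∘ length) (select-++ p xs ys) ⟩
  + length (select p xs ++ select p ys)              ≡⟨ cong +_ (length-++ (select p xs)) ⟩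
  + (length (select p xs) ℕ.+ length (select p ys))  ≡⟨ ℤP.pos-+ (length (select p xs)) (length (select p ys)) ⟩
  + length (select p xs) + + length (select p ys)    ∎
  where open ≡-Reasoning

+length-select-replicate : ∀ {A : Set} (p : A → Bool) n x → + length (select p (replicate n x)) ≡ bit (p x) * + n
+length-select-replicate p n x rewrite select-replicate p n x with p x
... | true  = trans (cong +_ (length-replicate n)) (sym (ℤP.*-identityˡ (+ n)))
... | false = refl

count-team₃ : ∀ p a b c → + length (select p (team₃ a b c)) ≡ weigh (λ v → bit (p (pt v))) a b c
count-team₃ p a b c = begin
  + length (select p (A ++ B ++ C))
    ≡⟨ +length-select-++ p A (B ++ C) ⟩
  + length (select p A) + + length (select p (B ++ C))
    ≡⟨ cong (_+_ (+ length (select p A))) (+length-select-++ p B C) ⟩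
  + length (select p A) + (+ length (select p B) + + length (select p C))
    ≡⟨ cong₂ _+_ (count a 0F) (cong₂ _+_ (count b 1F) (count c 2F)) ⟩
  weigh (λ v → bit (p (pt v))) a b c
    ∎
  where
  open ≡-Reasoning
  A B C : List (Asg σ₃)
  A = replicate a (pt 0F)
  B = replicate b (pt 1F)
  C = replicate c (pt 2F)
  count : ∀ n v → + length (select p (replicate n (pt v))) ≡ bit (p (pt v)) * + n
  count n v = +length-select-replicate p n (pt v)

length-team₃ : ∀ a b c → + length (team₃ a b c) ≡ weigh (λ _ → 1ℤ) a b c
length-team₃ a b c = trans (cong (+_ ∘ length) (sym (select-true (team₃ a b c)))) (count-team₃ (λ _ → true) a b c)

-- Probabilistic atoms as signs of linear functionals of the value counts

threshold-weights : CO σ₃ → ℚ → Fin 3 → ℤ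
threshold-weights α ε v = bit (holds α v) * ↧ ε - ↥ ε

comparison-weights : CO σ₃ → CO σ₃ → Fin 3 → ℤ
comparison-weights α β v = bit (holds α v) - bit (holds β v)

threshold-margin : ∀ α ε a b c →
  + cnt F₀ α (team₃ a b c) * ↧ ε - ↥ ε * + length (team₃ a b c) ≡ weigh (threshold-weights α ε) a b c
threshold-margin α ε a b c =
  trans (cong₂ (λ n N → n * ↧ ε - ↥ ε * N) (count-team₃ (evalCO F₀ α) a b c) (length-team₃ a b c))
        (distribute (x 0F) (x 1F) (x 2F) (+ a) (+ b) (+ c) (↧ ε) (↥ ε))
  where
  x : Fin 3 → ℤ
  x = bit ∘ holds α
  distribute : ∀ x₀ x₁ x₂ A B C Q P →
    (x₀ * A + (x₁ * B + x₂ * C)) * Q - P * (1ℤ * A + (1ℤ * B + 1ℤ * C))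
      ≡ (x₀ * Q - P) * A + ((x₁ * Q - P) * B + (x₂ * Q - P) * C)
  distribute = solve-∀

comparison-margin : ∀ α β a b c →
  + cnt F₀ α (team₃ a b c) - + cnt F₀ β (team₃ a b c) ≡ weigh (comparison-weights α β) a b c
comparison-margin α β a b c =
  trans (cong₂ _-_ (count-team₃ (evalCO F₀ α) a b c) (count-team₃ (evalCO F₀ β) a b c))
        (distribute (x 0F) (x 1F) (x 2F) (y 0F) (y 1F) (y 2F) (+ a) (+ b) (+ c))
  where
  x y : Fin 3 → ℤ
  x = bit ∘ holds α
  y = bit ∘ holds β
  distribute : ∀ x₀ x₁ x₂ y₀ y₁ y₂ A B C →
    (x₀ * A + (x₁ * B + x₂ * C)) - (y₀ * A + (y₁ * B + y₂ * C))
      ≡ (x₀ - y₀) * A + ((x₁ - y₁) * B + (x₂ - y₂) * C)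
  distribute = solve-∀

module _ (α : CO σ₃) (ε : ℚ) (0≤ε : 0ℚ ℚ.≤ ε) (ε≤1 : ε ℚ.≤ 1ℚ) (a b c : ℕ) where

  private
    T : List (Asg σ₃)
    T = team₃ (suc a) b c
    m : ℕ
    m = length (team₃ a b c)

  sat-Pr≥ : sat F₀ T (Pr≥ α ε 0≤ε ε≤1) ⇔ 0ℤ ℤ.≤ weigh (threshold-weights α ε) (suc a) b c
  sat-Pr≥ = subst (λ x → sat F₀ T (Pr≥ α ε 0≤ε ε≤1) ⇔ 0ℤ ℤ.≤ x) (threshold-margin α ε (suc a) b c)
                  (≤⇔0≤- ⇔-∘ ≤-/-suc ε (+ cnt F₀ α T) m)

  sat-Pr> : sat F₀ T (Pr> α ε 0≤ε ε≤1) ⇔ 0ℤ ℤ.< weigh (threshold-weights α ε) (suc a) b c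
  sat-Pr> = subst (λ x → sat F₀ T (Pr> α ε 0≤ε ε≤1) ⇔ 0ℤ ℤ.< x) (threshold-margin α ε (suc a) b c)
                  (<⇔0<- ⇔-∘ <-/-suc ε (+ cnt F₀ α T) m)

module _ (α β : CO σ₃) (a b c : ℕ) where

  private
    T : List (Asg σ₃)
    T = team₃ (suc a) b c
    m : ℕ
    m = length (team₃ a b c)

  sat-Pr≥Pr : sat F₀ T (Pr≥Pr α β) ⇔ 0ℤ ℤ.≤ weigh (comparison-weights α β) (suc a) b c
  sat-Pr≥Pr = subst (λ x → sat F₀ T (Pr≥Pr α β) ⇔ 0ℤ ℤ.≤ x) (comparison-margin α β (suc a) b c)
                    (≤⇔0≤- ⇔-∘ /-suc-≤-/-suc (+ cnt F₀ β T) (+ cnt F₀ α T) m)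

  sat-Pr>Pr : sat F₀ T (Pr>Pr α β) ⇔ 0ℤ ℤ.< weigh (comparison-weights α β) (suc a) b c
  sat-Pr>Pr = subst (λ x → sat F₀ T (Pr>Pr α β) ⇔ 0ℤ ℤ.< x) (comparison-margin α β (suc a) b c)
                    (<⇔0<- ⇔-∘ /-suc-<-/-suc (+ cnt F₀ β T) (+ cnt F₀ α T) m)

+-double : ∀ n k → + (n ℕ.+ (k ℕ.+ k)) ≡ + n + (+ k + + k)
+-double n k = trans (ℤP.pos-+ n (k ℕ.+ k)) (cong (_+_ (+ n)) (ℤP.pos-+ k k))

T⁺ T⁻ : ℕ → List (Asg σ₃)
T⁺ k = team₃ (suc k) (suc (k ℕ.+ k)) 2
T⁻ k = team₃ (suc k) (3 ℕ.+ (k ℕ.+ k)) 2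

slope offset shift : (Fin 3 → ℤ) → ℤ
slope  ℓ = ℓ 0F + + 2 * ℓ 1F
offset ℓ = ℓ 0F + ℓ 1F + + 2 * ℓ 2F
shift  ℓ = + 2 * ℓ 1F

weigh-T⁺ : ∀ ℓ k → weigh ℓ (suc k) (suc (k ℕ.+ k)) 2 ≡ slope ℓ * + k + offset ℓ
weigh-T⁺ ℓ k = trans (cong₂ (λ A B → ℓ 0F * A + (ℓ 1F * B + ℓ 2F * + 2)) (ℤP.pos-+ 1 k) (+-double 1 k))
                     (affine (ℓ 0F) (ℓ 1F) (ℓ 2F) (+ k))
  where
  affine : ∀ l₀ l₁ l₂ K → l₀ * (1ℤ + K) + (l₁ * (1ℤ + (K + K)) + l₂ * + 2)
                            ≡ (l₀ + + 2 * l₁) * K + (l₀ + l₁ + + 2 * l₂)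
  affine = solve-∀

weigh-T⁻ : ∀ ℓ k → weigh ℓ (suc k) (3 ℕ.+ (k ℕ.+ k)) 2 ≡ slope ℓ * + k + offset ℓ + shift ℓ
weigh-T⁻ ℓ k = trans (cong₂ (λ A B → ℓ 0F * A + (ℓ 1F * B + ℓ 2F * + 2)) (ℤP.pos-+ 1 k) (+-double 3 k))
                     (affine (ℓ 0F) (ℓ 1F) (ℓ 2F) (+ k))
  where
  affine : ∀ l₀ l₁ l₂ K → l₀ * (1ℤ + K) + (l₁ * (+ 3 + (K + K)) + l₂ * + 2)
                            ≡ (l₀ + + 2 * l₁) * K + (l₀ + l₁ + + 2 * l₂) + + 2 * l₁
  affine = solve-∀

KernelStable : (Fin 3 → ℤ) → Set
KernelStable ℓ = slope ℓ ≡ 0ℤ → offset ℓ ≤ₛ offset ℓ + shift ℓ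

eventually-weigh-≤ₛ : ∀ ℓ → KernelStable ℓ →
  Eventually (λ k → weigh ℓ (suc k) (suc (k ℕ.+ k)) 2 ≤ₛ weigh ℓ (suc k) (3 ℕ.+ (k ℕ.+ k)) 2)
eventually-weigh-≤ₛ ℓ stable =
  eventually-map (λ {k} → subst₂ _≤ₛ_ (sym (weigh-T⁺ ℓ k)) (sym (weigh-T⁻ ℓ k)))
                 (eventually-≤ₛ (slope ℓ) (offset ℓ) (shift ℓ) stable)

comparison-kernelStable : ∀ α β → KernelStable (comparison-weights α β)
comparison-kernelStable α β = kernel (holds α 0F) (holds β 0F) (holds α 1F) (holds β 1F) (holds α 2F) (holds β 2F)
  where
  -- bit x - bit y lies in {-1, 0, 1}, so the slope ℓ₀ + 2ℓ₁ vanishes only if ℓ₁ = 0.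
  kernel : ∀ x₀ y₀ x₁ y₁ x₂ y₂ →
    KernelStable (λ where 0F → bit x₀ - bit y₀ ; 1F → bit x₁ - bit y₁ ; 2F → bit x₂ - bit y₂)
  kernel x₀     y₀     true  true  x₂ y₂ _ = ≤ₛ-+-nonNeg (+≤+ z≤n)
  kernel x₀     y₀     false false x₂ y₂ _ = ≤ₛ-+-nonNeg (+≤+ z≤n)
  kernel true   true   true  false x₂ y₂ ()
  kernel true   false  true  false x₂ y₂ ()
  kernel false  true   true  false x₂ y₂ ()
  kernel false  false  true  false x₂ y₂ ()
  kernel true   true   false true  x₂ y₂ ()
  kernel true   false  false true  x₂ y₂ ()
  kernel false  true   false true  x₂ y₂ ()
  kernel false  false  false true  x₂ y₂ ()

drop-multiple : ∀ {u} x c → u ≡ 0ℤ → x + c * u ≡ x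
drop-multiple x c refl = trans (cong (_+_ x) (ℤP.*-zeroʳ c)) (ℤP.+-identityʳ x)

threshold-kernelStable : ∀ α ε → 0ℚ ℚ.≤ ε → ε ℚ.≤ 1ℚ → KernelStable (threshold-weights α ε)
threshold-kernelStable α ε 0≤ε ε≤1 = kernel (holds α 0F) (holds α 1F) (holds α 2F)
  where
  P Q : ℤ
  P = ↥ ε
  Q = ↧ ε

  0≤P : 0ℤ ℤ.≤ P
  0≤P = subst (0ℤ ℤ.≤_) (ℤP.*-identityʳ P) (ℚP.drop-*≤* 0≤ε)

  P≤Q : P ℤ.≤ Q
  P≤Q = subst₂ ℤ._≤_ (ℤP.*-identityʳ P) (ℤP.*-identityˡ Q) (ℚP.drop-*≤* ε≤1)

  0<Q : 0ℤ ℤ.< Q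
  0<Q = +<+ (s≤s z≤n)

  -- Only for x₀ = true, x₁ = false can the shift be negative; the slope then vanishes iff
  -- Q = 3P, i.e. ε = 1/3, and the offset is 5P or -P according to x₂.
  kernel : ∀ x₀ x₁ x₂ →
    KernelStable (λ where 0F → bit x₀ * Q - P ; 1F → bit x₁ * Q - P ; 2F → bit x₂ * Q - P)
  kernel false x₁ x₂ u≡0 =
    ≤ₛ-+-nonNeg (subst (0ℤ ℤ.≤_) (sym (trans (shift≡ (bit x₁) Q P) (drop-multiple P 1ℤ u≡0))) 0≤P)
    where shift≡ : ∀ X₁ Q P → + 2 * (X₁ * Q - P) ≡ P + 1ℤ * ((0ℤ - P) + + 2 * (X₁ * Q - P))
          shift≡ = solve-∀
  kernel true true x₂ _ =
    ≤ₛ-+-nonNeg (subst (0ℤ ℤ.≤_) (sym (shift≡ Q P)) (ℤP.+-mono-≤ 0≤Q-P 0≤Q-P))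
    where 0≤Q-P : 0ℤ ℤ.≤ Q - P
          0≤Q-P = ℤP.i≤j⇒0≤j-i P≤Q
          shift≡ : ∀ Q P → + 2 * (1ℤ * Q - P) ≡ (Q - P) + (Q - P)
          shift≡ = solve-∀
  kernel true false true u≡0 =
    ≤ₛ-pos (subst (0ℤ ℤ.<_) (sym (trans (sum≡ Q P) (drop-multiple Q (+ 2) u≡0))) 0<Q)
    where sum≡ : ∀ Q P → (1ℤ * Q - P) + (0ℤ - P) + + 2 * (1ℤ * Q - P) + + 2 * (0ℤ - P)
                           ≡ Q + + 2 * ((1ℤ * Q - P) + + 2 * (0ℤ - P))
          sum≡ = solve-∀
  kernel true false false u≡0 =
    subst (λ d → v ≤ₛ v + d) (sym (trans (shift≡ Q P) (drop-multiple (+ 2 * v) -[1+ 1 ] u≡0))) (≤ₛ-+-multiple 2 v)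
    where v : ℤ
          v = (1ℤ * Q - P) + (0ℤ - P) + + 2 * (0ℤ - P)
          shift≡ : ∀ Q P → + 2 * (0ℤ - P)
                           ≡ + 2 * ((1ℤ * Q - P) + (0ℤ - P) + + 2 * (0ℤ - P))
                             + -[1+ 1 ] * ((1ℤ * Q - P) + + 2 * (0ℤ - P))
          shift≡ = solve-∀

third : ℚ
third = + 1 / 3

0≤third : 0ℚ ℚ.≤ third
0≤third = *≤* (+≤+ z≤n)

third≤1 : third ℚ.≤ 1ℚ
third≤1 = *≤* (+≤+ (s≤s z≤n))

φ : PCO σ₃
φ = neqᶜ 0F 2F ⊃ Pr≥ (eqᶜ 0F 0F) third 0≤third third≤1

-- 3·#0 - (#0 + #1), the margin of φ: slope 0 and offset 1, but shift -2.
φ-weights : Fin 3 → ℤ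
φ-weights 0F = + 2
φ-weights 1F = -1ℤ
φ-weights 2F = 0ℤ

select-≠2 : ∀ a b c → select (evalCO F₀ (neqᶜ 0F 2F)) (team₃ a b c) ≡ team₃ a b 0
select-≠2 a b c = begin
  select p (A ++ B ++ C)                     ≡⟨ select-++ p A (B ++ C) ⟩
  select p A ++ select p (B ++ C)            ≡⟨ cong (select p A ++_) (select-++ p B C) ⟩
  select p A ++ select p B ++ select p C     ≡⟨ cong₂ _++_ (select-replicate p a (pt 0F))
                                                 (cong₂ _++_ (select-replicate p b (pt 1F)) (select-replicate p c (pt 2F))) ⟩
  team₃ a b 0                                ∎
  where
  open ≡-Reasoning
  p : Asg σ₃ → Bool
  p = evalCO F₀ (neqᶜ 0F 2F)
  A B C : List (Asg σ₃)
  A = replicate a (pt 0F)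
  B = replicate b (pt 1F)
  C = replicate c (pt 2F)

-- After restricting to X ≠ 2 the count of 2 is 0, so the threshold weights of Pr(X = 0) ≥ 1/3
-- agree definitionally with φ-weights.
sat-φ : ∀ a b c → sat F₀ (team₃ (suc a) b c) φ ⇔ 0ℤ ℤ.≤ weigh φ-weights (suc a) b c
sat-φ a b c = subst (λ T → sat F₀ T (Pr≥ (eqᶜ 0F 0F) third 0≤third third≤1)
                              ⇔ 0ℤ ℤ.≤ weigh φ-weights (suc a) b c)
                    (sym (select-≠2 (suc a) b c)) (sat-Pr≥ (eqᶜ 0F 0F) third 0≤third third≤1 a b 0)

φ-T⁺ : ∀ k → sat F₀ (T⁺ k) φ
φ-T⁺ k = from (sat-φ k (suc (k ℕ.+ k)) 2) (subst (0ℤ ℤ.≤_) (sym (weigh-T⁺ φ-weights k)) (+≤+ z≤n))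

φ-T⁻ : ∀ k → ¬ sat F₀ (T⁻ k) φ
φ-T⁻ k h with subst (0ℤ ℤ.≤_) (weigh-T⁻ φ-weights k) (to (sat-φ k (3 ℕ.+ (k ℕ.+ k)) 2) h)
... | ()

-- Formulas of P cannot separate the two families

Preserved : PCO σ₃ → Set
Preserved ψ = Eventually (λ k → sat F₀ (T⁺ k) ψ → sat F₀ (T⁻ k) ψ)

preserved-by-margin : ∀ ψ (R : ℤ → Set) → (∀ {x y} → x ≤ₛ y → R x → R y) → ∀ ℓ → KernelStable ℓ →
                      (∀ a b c → sat F₀ (team₃ (suc a) b c) ψ ⇔ R (weigh ℓ (suc a) b c)) → Preserved ψ
preserved-by-margin ψ R transfer ℓ stable sat⇔ =
  eventually-map (λ {k} x≤ₛy → from (sat⇔ k _ 2) ∘ transfer x≤ₛy ∘ to (sat⇔ k _ 2))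
                 (eventually-weigh-≤ₛ ℓ stable)

all-values : ∀ {P : Asg σ₃ → Set} a b c → All P (team₃ (suc a) (suc b) (suc c)) → ∀ v → P (pt v)
all-values a b c h 0F = All.head h
all-values a b c h 1F = All.head (All.++⁻ʳ (replicate (suc a) (pt 0F)) h)
all-values a b c h 2F = All.head (All.++⁻ʳ (replicate (suc b) (pt 1F)) (All.++⁻ʳ (replicate (suc a) (pt 0F)) h))

eqᵖ-fails : ∀ i v a b c → ¬ sat F₀ (team₃ (suc a) (suc b) (suc c)) (eqᵖ i v)
eqᵖ-fails i v a b c h with trans (all-values a b c h 0F) (sym (all-values a b c h 1F))
... | ()

neqᵖ-fails : ∀ i v a b c → ¬ sat F₀ (team₃ (suc a) (suc b) (suc c)) (neqᵖ i v)
neqᵖ-fails i v a b c h = all-values a b c h v refl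

preserved : ∀ ψ → InP ψ → Preserved ψ
preserved (eqᵖ i v)           _ = 0 , λ {k} _ h → ⊥-elim (eqᵖ-fails i v k (k ℕ.+ k) 1 h)
preserved (neqᵖ i v)          _ = 0 , λ {k} _ h → ⊥-elim (neqᵖ-fails i v k (k ℕ.+ k) 1 h)
preserved ψ@(Pr≥ α ε 0≤ε ε≤1) _ = preserved-by-margin ψ (0ℤ ℤ.≤_) proj₁
  (threshold-weights α ε) (threshold-kernelStable α ε 0≤ε ε≤1) (sat-Pr≥ α ε 0≤ε ε≤1)
preserved ψ@(Pr> α ε 0≤ε ε≤1) _ = preserved-by-margin ψ (0ℤ ℤ.<_) proj₂
  (threshold-weights α ε) (threshold-kernelStable α ε 0≤ε ε≤1) (sat-Pr> α ε 0≤ε ε≤1)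
preserved ψ@(Pr≥Pr α β)       _ = preserved-by-margin ψ (0ℤ ℤ.≤_) proj₁
  (comparison-weights α β) (comparison-kernelStable α β) (sat-Pr≥Pr α β)
preserved ψ@(Pr>Pr α β)       _ = preserved-by-margin ψ (0ℤ ℤ.<_) proj₂
  (comparison-weights α β) (comparison-kernelStable α β) (sat-Pr>Pr α β)
preserved (ψ ∧ᵖ χ) (ψ∈P , χ∈P) =
  eventually-map (λ (f , g) (hψ , hχ) → f hψ , g hχ) (eventually-zip (preserved ψ ψ∈P) (preserved χ χ∈P))
preserved (ψ ⊔ χ)  (ψ∈P , χ∈P) =
  eventually-map (λ (f , g) → Data.Sum.map f g) (eventually-zip (preserved ψ ψ∈P) (preserved χ χ∈P))

φ-not-in-P : ¬ Σ (PCO σ₃) (λ ψ → InP ψ × Equivalent σ₃ φ ψ)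
φ-not-in-P (ψ , ψ∈P , φ≡ψ) =
  let M , pres = preserved ψ ψ∈P
      ψ-T⁺ = proj₁ (φ≡ψ (causalMultiteam (T⁺ M))) (φ-T⁺ M)
  in φ-T⁻ M (proj₂ (φ≡ψ (causalMultiteam (T⁻ M))) (pres ℕP.≤-refl ψ-T⁺))

InP⇒InP⊃ : ∀ {σ} (ψ : PCO σ) → InP ψ → InP⊃ ψ
InP⇒InP⊃ (eqᵖ _ _)       _         = tt
InP⇒InP⊃ (neqᵖ _ _)      _         = tt
InP⇒InP⊃ (Pr≥ _ _ _ _)   _         = tt
InP⇒InP⊃ (Pr> _ _ _ _)   _         = tt
InP⇒InP⊃ (Pr≥Pr _ _)     _         = tt
InP⇒InP⊃ (Pr>Pr _ _)     _         = tt
InP⇒InP⊃ (ψ ∧ᵖ χ)        (ψ∈ , χ∈) = InP⇒InP⊃ ψ ψ∈ , InP⇒InP⊃ χ χ∈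
InP⇒InP⊃ (ψ ⊔ χ)         (ψ∈ , χ∈) = InP⇒InP⊃ ψ ψ∈ , InP⇒InP⊃ χ χ∈

proposition1 : ((σ : Sig) (φ : PCO σ) → InP φ → Σ (PCO σ) (λ ψ → InP⊃ ψ × Equivalent σ φ ψ))
               × Σ Sig (λ σ → Σ (PCO σ) (λ φ → InP⊃ φ × ¬ Σ (PCO σ) (λ ψ → InP ψ × Equivalent σ φ ψ)))
proposition1 = (λ _ ψ ψ∈P → ψ , InP⇒InP⊃ ψ ψ∈P , λ _ → id , id) , σ₃ , φ , tt , φ-not-in-P
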